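{- Let $(S_\bot,M)$ be a $C$-monoid where $M$ is an ada, let $\theta$ be a maximal congruence on $M$, let $E_\theta=\{(s,t)\in S_\bot\times S_\bot: \beta[s,t]=\beta[t,t]\text{ for some }\beta\in M\text{ with }(\beta,T)\in\theta\}$ (an equivalence relation on $S_\bot$), and let $S_{\theta_\bot}=S_\bot/E_\theta$, regarded as a pointed set with base point $\overline{\bot}$ (the $E_\theta$-class of $\bot$). Then the map $\phi_\theta:S_\bot\to\mathcal{T}_o(S_{\theta_\bot})$, $\phi_\theta(s)=\psi^s_\theta$ with $\psi^s_\theta(\overline{t})=\overline{t\cdot s}$, is well defined and is a monoid homomorphism (with $\phi_\theta(1)=id_{S_{\theta_\bot}}$) sending $\bot$ to the constant map $\zeta_{\overline{\bot}}$.
   Context: A $C$-algebra is an algebra $(M,\vee,\wedge,\neg)$ of type $(2,2,1)$ satisfying, for all $\alpha,\beta,\gamma$: $\neg\neg\alpha=\alpha$; $\neg(\alpha\wedge\beta)=\neg\alpha\vee\neg\beta$; $(\alpha\wedge\beta)\wedge\gamma=\alpha\wedge(\beta\wedge\gamma)$; $\alpha\wedge(\beta\vee\gamma)=(\alpha\wedge\beta)\vee(\alpha\wedge\gamma)$; $(\alpha\vee\beta)\wedge\gamma=(\alpha\wedge\gamma)\vee(\neg\alpha\wedge\beta\wedge\gamma)$; $\alpha\vee(\alpha\wedge\beta)=\alpha$; $(\alpha\wedge\beta)\vee(\beta\wedge\alpha)=(\beta\wedge\alpha)\vee(\alpha\wedge\beta)$. A $C$-algebra with $T,F,U$ has constants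 $T$ (two-sided identity for $\wedge$), $F$ (two-sided identity for $\vee$), $U$ (fixed point of $\neg$). An ada is a $C$-algebra with $T,F,U$ and a unary operation $(\ )^\downarrow$ with $F^\downarrow=F$, $U^\downarrow=F$, $T^\downarrow=T$, $\alpha\wedge\beta^\downarrow=\alpha\wedge(\alpha\wedge\beta)^\downarrow$, $\alpha^\downarrow\vee\neg(\alpha^\downarrow)=T$, $\alpha=\alpha^\downarrow\vee\alpha$. Write $\alpha\llbracket\beta,\gamma\rrbracket=(\alpha\wedge\beta)\vee(\neg\alpha\wedge\gamma)$. A maximal congruence is a congruence on $M$ maximal among those different from $M\times M$. A $C$-set is a pair $(S_\bot,M)$, $S_\bot$ a pointed set with base point $\bot$, $M$ a $C$-algebra with $T,F,U$, with a map $(\alpha,s,t)\mapsto\alpha[s,t]$, $M\times S_\bot\times S_\bot\to S_\bot$, such that: $U[s,t]=\bot$; $F[s,t]=t$; $(\neg\alpha)[s,t]=\alpha[t,s]$; $\alpha[\alpha[s,t],u]=\alpha[s,u]$; $\alpha[s,\alpha[t,u]]=\alpha[s,u]$; $(\alpha\wedge\beta)[s,t]=\alpha[\beta[s,t],t]$; $\alpha[\beta[s,t],\beta[u,v]]=\beta[\alpha[s,u],\alpha[t,v]]$; and $\alpha[s,t]=\alpha[t,t]\Rightarrow(\alpha\wedge\beta)[s,t]=(\alpha\wedge\beta)[t,t]$. A $C$-monoid is a $C$-set $(S_\bot,M)$ where $(S_\bot,\cdot)$ is a monoid with identity $1$ and zero $\bot$ (the base point), with a map $\circ:S_\bot\times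 M\to M$ such that for all $s,t,r,u\in S_\bot,\alpha,\beta\in M$: $\bot\circ\alpha=U$; $t\circ U=U$; $1\circ\alpha=\alpha$; $s\circ(\neg\alpha)=\neg(s\circ\alpha)$; $s\circ(\alpha\wedge\beta)=(s\circ\alpha)\wedge(s\circ\beta)$; $(s\cdot t)\circ\alpha=s\circ(t\circ\alpha)$; $\alpha[s,t]\cdot u=\alpha[s\cdot u,t\cdot u]$; $r\cdot\alpha[s,t]=(r\circ\alpha)[r\cdot s,r\cdot t]$; $\alpha[s,t]\circ\beta=\alpha\llbracket s\circ\beta,t\circ\beta\rrbracket$. For a pointed set $Y_\bot$ with base point $\bot$, $\mathcal{T}_o(Y_\bot)$ is the set of maps $f:Y_\bot\to Y_\bot$ with $f(\bot)=\bot$, a monoid under left-to-right composition $(f\cdot g)(y)=g(f(y))$, identity $id_{Y_\bot}$, and zero the constant map $\zeta_\bot$. -}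

module Defs where

open import Data.Product using (Σ; _×_; _,_)
open import Relation.Binary.PropositionalEquality using (_≡_)
open import Relation.Binary.Core using (Rel)
open import Relation.Binary.Structures using (IsEquivalence)
open import Relation.Nullary using (¬_)
open import Level using (0ℓ)

record CAlgebraTFU : Set₁ where
  infixr 6 _∧_
  infixr 5 _∨_
  field
    Carrier : Set
    _∨_ _∧_ : Carrier → Carrier → Carrier
    neg : Carrier → Carrier
    T F U : Carrier
    neg-neg   : ∀ a → neg (neg a) ≡ a
    deMorgan  : ∀ a b → neg (a ∧ b) ≡ neg a ∨ neg b
    ∧-assoc   : ∀ a b c → (a ∧ b) ∧ c ≡ a ∧ (b ∧ c)
    ∧-distˡ   : ∀ a b c → a ∧ (b ∨ c) ≡ (a ∧ b) ∨ (a ∧ c)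
    ∨∧-dist   : ∀ a b c → (a ∨ b) ∧ c ≡ (a ∧ c) ∨ (neg a ∧ b ∧ c)
    absorb    : ∀ a b → a ∨ (a ∧ b) ≡ a
    ∧∨-comm   : ∀ a b → (a ∧ b) ∨ (b ∧ a) ≡ (b ∧ a) ∨ (a ∧ b)
    T-identityˡ : ∀ a → T ∧ a ≡ a
    T-identityʳ : ∀ a → a ∧ T ≡ a
    F-identityˡ : ∀ a → F ∨ a ≡ a
    F-identityʳ : ∀ a → a ∨ F ≡ a
    neg-U       : neg U ≡ U

  _⟦_,_⟧ : Carrier → Carrier → Carrier → Carrier
  a ⟦ b , c ⟧ = (a ∧ b) ∨ (neg a ∧ c)

record Ada : Set₁ where
  field
    alg : CAlgebraTFU
  open CAlgebraTFU alg
  field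
    _↓ : Carrier → Carrier
    F↓ : F ↓ ≡ F
    U↓ : U ↓ ≡ F
    T↓ : T ↓ ≡ T
    ↓-∧     : ∀ a b → a ∧ (b ↓) ≡ a ∧ ((a ∧ b) ↓)
    ↓-excl  : ∀ a → (a ↓) ∨ neg (a ↓) ≡ T
    ↓-absorb : ∀ a → a ≡ (a ↓) ∨ a

record CMonoid (M : CAlgebraTFU) : Set₁ where
  open CAlgebraTFU M renaming (Carrier to A)
  infixl 7 _·_
  infixr 8 _∘_
  field
    S : Set
    ⊥ : S
    _[_,_] : A → S → S → S
    U-if    : ∀ s t → U [ s , t ] ≡ ⊥
    F-if    : ∀ s t → F [ s , t ] ≡ t
    neg-if  : ∀ a s t → (neg a) [ s , t ] ≡ a [ t , s ]
    if-l    : ∀ a s t u → a [ a [ s , t ] , u ] ≡ a [ s , u ]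
    if-r    : ∀ a s t u → a [ s , a [ t , u ] ] ≡ a [ s , u ]
    ∧-if    : ∀ a b s t → (a ∧ b) [ s , t ] ≡ a [ b [ s , t ] , t ]
    if-comm : ∀ a b s t u v →
              a [ b [ s , t ] , b [ u , v ] ] ≡ b [ a [ s , u ] , a [ t , v ] ]
    if-impl : ∀ a b s t → a [ s , t ] ≡ a [ t , t ] →
              (a ∧ b) [ s , t ] ≡ (a ∧ b) [ t , t ]
    _·_      : S → S → S
    one      : S
    ·-assoc  : ∀ s t u → (s · t) · u ≡ s · (t · u)
    ·-identityˡ : ∀ s → one · s ≡ s
    ·-identityʳ : ∀ s → s · one ≡ s
    ·-zeroˡ  : ∀ s → ⊥ · s ≡ ⊥
    ·-zeroʳ  : ∀ s → s · ⊥ ≡ ⊥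
    _∘_      : S → A → A
    ⊥∘       : ∀ a → ⊥ ∘ a ≡ U
    ∘U       : ∀ t → t ∘ U ≡ U
    one∘     : ∀ a → one ∘ a ≡ a
    ∘-neg    : ∀ s a → s ∘ (neg a) ≡ neg (s ∘ a)
    ∘-∧      : ∀ s a b → s ∘ (a ∧ b) ≡ (s ∘ a) ∧ (s ∘ b)
    ·-∘      : ∀ s t a → (s · t) ∘ a ≡ s ∘ (t ∘ a)
    if-·     : ∀ a s t u → a [ s , t ] · u ≡ a [ s · u , t · u ]
    ·-if     : ∀ r a s t → r · a [ s , t ] ≡ (r ∘ a) [ r · s , r · t ]
    if-∘     : ∀ a s t b → (a [ s , t ]) ∘ b ≡ a ⟦ (s ∘ b) , (t ∘ b) ⟧

-- Congruences on an ada (compatible with ∨, ∧, ¬ and ↓; constants are automatic).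
record IsCongruence (M : Ada) (θ : Rel (CAlgebraTFU.Carrier (Ada.alg M)) 0ℓ) : Set where
  open Ada M
  open CAlgebraTFU alg
  field
    isEquivalence : IsEquivalence θ
    ∨-cong : ∀ {a a' b b'} → θ a a' → θ b b' → θ (a ∨ b) (a' ∨ b')
    ∧-cong : ∀ {a a' b b'} → θ a a' → θ b b' → θ (a ∧ b) (a' ∧ b')
    neg-cong : ∀ {a a'} → θ a a' → θ (neg a) (neg a')
    ↓-cong : ∀ {a a'} → θ a a' → θ (a ↓) (a' ↓)

IsFull : {A : Set} → Rel A 0ℓ → Set
IsFull {A} θ = ∀ (a b : A) → θ a b

record IsMaximalCongruence (M : Ada) (θ : Rel (CAlgebraTFU.Carrier (Ada.alg M)) 0ℓ) : Set₁ where
  field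
    isCongruence : IsCongruence M θ
    proper       : ¬ IsFull θ
    maximal      : ∀ (φ : Rel (CAlgebraTFU.Carrier (Ada.alg M)) 0ℓ) →
                   IsCongruence M φ → (∀ {a b} → θ a b → φ a b) →
                   ¬ IsFull φ → ∀ {a b} → φ a b → θ a b

module _ (M : Ada) (SM : CMonoid (Ada.alg M)) where
  open CAlgebraTFU (Ada.alg M)
  open CMonoid SM

  E : Rel (CAlgebraTFU.Carrier (Ada.alg M)) 0ℓ → Rel S 0ℓ
  E θ s t = Σ Carrier λ β → θ β T × (β [ s , t ] ≡ β [ t , t ])

-- 𝒯ₒ(Y_⊥) for the quotient Y/≈ of a pointed set (Y, ⊥) by an equivalence ≈:
-- maps on classes, i.e. ≈-respecting maps on Y preserving the class of ⊥,
-- compared pointwise up to ≈.  Monoid: left-to-right composition.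
record Tₒ (Y : Set) (_≈_ : Rel Y 0ℓ) (⊥ : Y) : Set where
  field
    fun  : Y → Y
    cong : ∀ {x y} → x ≈ y → fun x ≈ fun y
    pres : fun ⊥ ≈ ⊥

module _ {Y : Set} {_≈_ : Rel Y 0ℓ} {⊥ : Y} (isEq : IsEquivalence _≈_) where
  open Tₒ
  open IsEquivalence isEq

  _≋_ : Tₒ Y _≈_ ⊥ → Tₒ Y _≈_ ⊥ → Set
  f ≋ g = ∀ y → fun f y ≈ fun g y

  _⨾_ : Tₒ Y _≈_ ⊥ → Tₒ Y _≈_ ⊥ → Tₒ Y _≈_ ⊥
  fun (f ⨾ g) y = fun g (fun f y)
  cong (f ⨾ g) p = cong g (cong f p)
  pres (f ⨾ g) = trans (cong g (pres f)) (pres g)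

  idₜ : Tₒ Y _≈_ ⊥
  fun idₜ y = y
  cong idₜ p = p
  pres idₜ = refl

  ζ : Tₒ Y _≈_ ⊥
  fun ζ _ = ⊥
  cong ζ _ = refl
  pres ζ = refl

module Submission where

open import Defs
open import Data.Product using (Σ; _×_; _,_)
open import Relation.Binary.Core using (Rel)
open import Relation.Binary.Structures using (IsEquivalence)
open import Relation.Binary.PropositionalEquality as P using (_≡_)
open P.≡-Reasoning

-- An E_θ-witness β only ever gets combined by ∧, so E_θ is an equivalence for any
-- congruence θ; right multiplication respects it because [_,_] commutes with ·.

module CSetProperties {M : CAlgebraTFU} (SM : CMonoid M) where
  open CMonoid SM

  if-congˡ : ∀ β {s s' t t'} u → β [ s , t ] ≡ β [ s' , t' ] → β [ s , u ] ≡ β [ s' , u ]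
  if-congˡ β {s} {s'} {t} {t'} u e = begin
    β [ s , u ]                ≡⟨ if-l β s t u ⟨
    β [ β [ s , t ] , u ]      ≡⟨ P.cong (β [_, u ]) e ⟩
    β [ β [ s' , t' ] , u ]    ≡⟨ if-l β s' t' u ⟩
    β [ s' , u ]               ∎

module EProperties (M : Ada) (SM : CMonoid (Ada.alg M))
    {θ : Rel (CAlgebraTFU.Carrier (Ada.alg M)) _} (θ-cong : IsCongruence M θ) where
  open CAlgebraTFU (Ada.alg M)
  open CMonoid SM
  open CSetProperties SM
  open IsCongruence θ-cong

  E-refl : ∀ {s} → E M SM θ s s
  E-refl = T , IsEquivalence.refl isEquivalence , P.refl

  E-reflexive : ∀ {s t} → s ≡ t → E M SM θ s t
  E-reflexive P.refl = E-refl

  E-sym : ∀ {s t} → E M SM θ s t → E M SM θ t s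
  E-sym {s} {t} (β , β≈T , e) = β , β≈T , P.sym (if-congˡ β s e)

  E-trans : ∀ {s t u} → E M SM θ s t → E M SM θ t u → E M SM θ s u
  E-trans {s} {t} {u} (β , β≈T , e₁) (γ , γ≈T , e₂) = β ∧ γ , β∧γ≈T , (begin
    (β ∧ γ) [ s , u ]          ≡⟨ if-congˡ (β ∧ γ) u (if-impl β γ s t e₁) ⟩
    (β ∧ γ) [ t , u ]          ≡⟨ ∧-if β γ t u ⟩
    β [ γ [ t , u ] , u ]      ≡⟨ P.cong (β [_, u ]) e₂ ⟩
    β [ γ [ u , u ] , u ]      ≡⟨ ∧-if β γ u u ⟨
    (β ∧ γ) [ u , u ]          ∎)
    where
    β∧γ≈T : θ (β ∧ γ) T
    β∧γ≈T = P.subst (θ (β ∧ γ)) (T-identityˡ T) (∧-cong β≈T γ≈T)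

  E-isEquivalence : IsEquivalence (E M SM θ)
  E-isEquivalence = record { refl = E-refl ; sym = E-sym ; trans = E-trans }

  E-·ʳ : ∀ {x y} s → E M SM θ x y → E M SM θ (x · s) (y · s)
  E-·ʳ {x} {y} s (β , β≈T , e) = β , β≈T , (begin
    β [ x · s , y · s ]        ≡⟨ if-· β x y s ⟨
    β [ x , y ] · s            ≡⟨ P.cong (_· s) e ⟩
    β [ y , y ] · s            ≡⟨ if-· β y y s ⟩
    β [ y · s , y · s ]        ∎)

  rightTranslation : S → Tₒ S (E M SM θ) ⊥
  Tₒ.fun  (rightTranslation s) t = t · s
  Tₒ.cong (rightTranslation s)   = E-·ʳ s
  Tₒ.pres (rightTranslation s)   = E-reflexive (·-zeroˡ s)

proposition3p4 : (M : Ada) (SM : CMonoid (Ada.alg M))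
    (θ : CAlgebraTFU.Carrier (Ada.alg M) → CAlgebraTFU.Carrier (Ada.alg M) → Set) →
    IsMaximalCongruence M θ →
    let open CMonoid SM in
    Σ (IsEquivalence (E M SM θ)) λ isEq →
    Σ (S → Tₒ S (E M SM θ) ⊥) λ φ →
      (∀ s t → E M SM θ (Tₒ.fun (φ s) t) (t · s))
      × (∀ s s' → _≋_ {⊥ = ⊥} isEq (φ (s · s')) (_⨾_ {⊥ = ⊥} isEq (φ s) (φ s')))
      × _≋_ {⊥ = ⊥} isEq (φ one) (idₜ {⊥ = ⊥} isEq)
      × _≋_ {⊥ = ⊥} isEq (φ ⊥) (ζ {⊥ = ⊥} isEq)
proposition3p4 M SM θ θ-max =
  E-isEquivalence , rightTranslation ,
  (λ _ _ → E-refl) ,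
  (λ s s' t → E-reflexive (P.sym (·-assoc t s s'))) ,
  (λ t → E-reflexive (·-identityʳ t)) ,
  (λ t → E-reflexive (·-zeroʳ t))
  where
  open CMonoid SM
  open EProperties M SM (IsMaximalCongruence.isCongruence θ-max)
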